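{- Let $G$ be any one of the sequent calculi $\mathbf{GCE}$, $\mathbf{GCM}$, $\mathbf{GCMC}$, $\mathbf{GCEN}$, $\mathbf{GCMN}$, $\mathbf{GCK}$. Then the cut rule is admissible in $G$: if $G\vdash\Gamma_1\Rightarrow\phi,\Delta_1$ and $G\vdash\phi,\Gamma_2\Rightarrow\Delta_2$, then $G\vdash\Gamma_1,\Gamma_2\Rightarrow\Delta_1,\Delta_2$.
   Context: Formulas are those of $\mathcal{L}_{\triangleright}$: built from atoms and $\bot$ with $\wedge,\vee,\to$ and binary $\triangleright$. A sequent $\Gamma\Rightarrow\Delta$ has finite multisets $\Gamma,\Delta$ of formulas. $\mathbf{G3W}$ has the rules: axioms $\Gamma,p\Rightarrow p,\Delta$ ($p$ atomic) and $\Gamma,\bot\Rightarrow\Delta$; $L\wedge$: from $\Gamma,\phi,\psi\Rightarrow\Delta$ infer $\Gamma,\phi\wedge\psi\Rightarrow\Delta$; $R\wedge$: from $\Gamma\Rightarrow\phi,\Delta$ and $\Gamma\Rightarrow\psi,\Delta$ infer $\Gamma\Rightarrow\phi\wedge\psi,\Delta$; $L\vee$: from $\Gamma,\phi\Rightarrow\Delta$ and $\Gamma,\psi\Rightarrow\Delta$ infer $\Gamma,\phi\vee\psi\Rightarrow\Delta$; $R\vee$: from $\Gamma\Rightarrow\phi,\psi,\Delta$ infer $\Gamma\Rightarrow\phi\vee\psi,\Delta$; $L\to$: from $\Gamma\Rightarrow\phi,\Delta$ and $\Gamma,\psi\Rightarrow\Delta$ infer $\Gamma,\phi\to\psi\Rightarrow\Delta$;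 $R\to$: from $\Gamma,\phi\Rightarrow\psi,\Delta$ infer $\Gamma\Rightarrow\phi\to\psi,\Delta$; weakening $Lw$: from $\Gamma\Rightarrow\Delta$ infer $\Gamma,\phi\Rightarrow\Delta$; $Rw$: from $\Gamma\Rightarrow\Delta$ infer $\Gamma\Rightarrow\phi,\Delta$. Write $\alpha\Leftrightarrow\beta$ for the pair of premises $\alpha\Rightarrow\beta$ and $\beta\Rightarrow\alpha$. Conditional rules (no side contexts): $(CE)$: from $\phi_0\Leftrightarrow\phi_1$ and $\psi_0\Leftrightarrow\psi_1$ infer $\phi_1\triangleright\psi_1\Rightarrow\phi_0\triangleright\psi_0$; $(CM)$: from $\phi_0\Leftrightarrow\phi_1$ and $\psi_1\Rightarrow\psi_0$ infer $\phi_1\triangleright\psi_1\Rightarrow\phi_0\triangleright\psi_0$; $(CMC)$ ($n\ge1$): from $\phi_0\Leftrightarrow\phi_i$ for all $1\le i\le n$ and $\psi_1,\dots,\psi_n\Rightarrow\psi_0$ infer $\phi_1\triangleright\psi_1,\dots,\phi_n\triangleright\psi_n\Rightarrow\phi_0\triangleright\psi_0$; $(CN)$: from $\Rightarrow\psi_0$ infer $\Rightarrow\phi_0\triangleright\psi_0$. $\mathbf{GCE},\mathbf{GCM},\mathbf{GCMC}$ are $\mathbf{G3W}$ plus $(CE)$, $(CM)$, $(CMC)$ respectively; $\mathbf{GCEN},\mathbf{GCMN}$ and $\mathbf{GCK}$ are $\mathbf{GCE},\mathbf{GCM},\mathbf{GCMC}$ plus $(CN)$, respectively. -}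

module Defs where

open import Data.Nat using (ℕ)
open import Data.List using (List; []; _∷_; _++_; map)
open import Data.List.NonEmpty using (List⁺; _∷_; toList)
open import Data.List.Relation.Unary.All using (All)
open import Data.List.Relation.Binary.Permutation.Propositional using (_↭_)
open import Data.Product using (_×_; proj₁; proj₂)

infixr 6 _∧'_
infixr 5 _∨'_
infixr 4 _⇒'_
infix 7 _▷_
data Fm : Set where
  atom : ℕ → Fm
  ⊥'   : Fm
  _∧'_ : Fm → Fm → Fm
  _∨'_ : Fm → Fm → Fm
  _⇒'_ : Fm → Fm → Fm
  _▷_  : Fm → Fm → Fm

-- Finite multisets are represented by lists; sequents are considered up to
-- permutation of either side (rule `perm` below), i.e. up to multiset equality.
Ctx : Set
Ctx = List Fm

data Sys : Set where
  GCE GCM GCMC GCEN GCMN GCK : Sys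

data HasCE : Sys → Set where
  ce : HasCE GCE
  cen : HasCE GCEN

data HasCM : Sys → Set where
  cm : HasCM GCM
  cmn : HasCM GCMN

data HasCMC : Sys → Set where
  cmc : HasCMC GCMC
  ck : HasCMC GCK

data HasCN : Sys → Set where
  cen : HasCN GCEN
  cmn : HasCN GCMN
  ck : HasCN GCK

infix 3 _⊢_⇒_
data _⊢_⇒_ (G : Sys) : Ctx → Ctx → Set where
  perm : ∀ {Γ Γ' Δ Δ'} → Γ ↭ Γ' → Δ ↭ Δ' → G ⊢ Γ ⇒ Δ → G ⊢ Γ' ⇒ Δ'
  ax   : ∀ {Γ Δ} p → G ⊢ atom p ∷ Γ ⇒ atom p ∷ Δ
  L⊥   : ∀ {Γ Δ} → G ⊢ ⊥' ∷ Γ ⇒ Δ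
  L∧   : ∀ {Γ Δ φ ψ} → G ⊢ φ ∷ ψ ∷ Γ ⇒ Δ → G ⊢ (φ ∧' ψ) ∷ Γ ⇒ Δ
  R∧   : ∀ {Γ Δ φ ψ} → G ⊢ Γ ⇒ φ ∷ Δ → G ⊢ Γ ⇒ ψ ∷ Δ → G ⊢ Γ ⇒ (φ ∧' ψ) ∷ Δ
  L∨   : ∀ {Γ Δ φ ψ} → G ⊢ φ ∷ Γ ⇒ Δ → G ⊢ ψ ∷ Γ ⇒ Δ → G ⊢ (φ ∨' ψ) ∷ Γ ⇒ Δ
  R∨   : ∀ {Γ Δ φ ψ} → G ⊢ Γ ⇒ φ ∷ ψ ∷ Δ → G ⊢ Γ ⇒ (φ ∨' ψ) ∷ Δ
  L→   : ∀ {Γ Δ φ ψ} → G ⊢ Γ ⇒ φ ∷ Δ → G ⊢ ψ ∷ Γ ⇒ Δ → G ⊢ (φ ⇒' ψ) ∷ Γ ⇒ Δ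
  R→   : ∀ {Γ Δ φ ψ} → G ⊢ φ ∷ Γ ⇒ ψ ∷ Δ → G ⊢ Γ ⇒ (φ ⇒' ψ) ∷ Δ
  Lw   : ∀ {Γ Δ φ} → G ⊢ Γ ⇒ Δ → G ⊢ φ ∷ Γ ⇒ Δ
  Rw   : ∀ {Γ Δ φ} → G ⊢ Γ ⇒ Δ → G ⊢ Γ ⇒ φ ∷ Δ
  CE   : HasCE G → ∀ {φ₀ φ₁ ψ₀ ψ₁} →
         G ⊢ φ₀ ∷ [] ⇒ φ₁ ∷ [] → G ⊢ φ₁ ∷ [] ⇒ φ₀ ∷ [] →
         G ⊢ ψ₀ ∷ [] ⇒ ψ₁ ∷ [] → G ⊢ ψ₁ ∷ [] ⇒ ψ₀ ∷ [] →
         G ⊢ (φ₁ ▷ ψ₁) ∷ [] ⇒ (φ₀ ▷ ψ₀) ∷ []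
  CM   : HasCM G → ∀ {φ₀ φ₁ ψ₀ ψ₁} →
         G ⊢ φ₀ ∷ [] ⇒ φ₁ ∷ [] → G ⊢ φ₁ ∷ [] ⇒ φ₀ ∷ [] →
         G ⊢ ψ₁ ∷ [] ⇒ ψ₀ ∷ [] →
         G ⊢ (φ₁ ▷ ψ₁) ∷ [] ⇒ (φ₀ ▷ ψ₀) ∷ []
  -- (CMC): the n ≥ 1 pairs (φᵢ, ψᵢ) are given as a nonempty list
  CMC  : HasCMC G → ∀ {φ₀ ψ₀} (cs : List⁺ (Fm × Fm)) →
         All (λ c → G ⊢ φ₀ ∷ [] ⇒ proj₁ c ∷ []) (toList cs) →
         All (λ c → G ⊢ proj₁ c ∷ [] ⇒ φ₀ ∷ []) (toList cs) →
         G ⊢ map proj₂ (toList cs) ⇒ ψ₀ ∷ [] →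
         G ⊢ map (λ c → proj₁ c ▷ proj₂ c) (toList cs) ⇒ (φ₀ ▷ ψ₀) ∷ []
  CN   : HasCN G → ∀ {φ₀ ψ₀} → G ⊢ [] ⇒ ψ₀ ∷ [] → G ⊢ [] ⇒ (φ₀ ▷ ψ₀) ∷ []

module Submission where

-- Cut is proved admissible in its context-sharing form (from Γ ⇒ A, Δ and A, Γ ⇒ Δ infer Γ ⇒ Δ)
-- by induction on A and, inside, on the derivation of the left premise. When A = φ ▷ ψ is
-- principal there, an induction on the right premise reaches the conditional rule instances in
-- which A is principal on the left, and the two instances compose into one, the cuts on φ and ψ
-- chaining their premises: (CE) with (CE), (CM) with (CM), (CMC) with (CMC) (every copy of A
-- among the antecedents being replaced by the antecedents of the left instance), and (CN) with
-- any of them.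
--
-- The context-sharing form needs contraction. It comes, together with weakening and the
-- invertibility of the left rules, from a single induction (transfer): a derivable sequent stays
-- derivable when each antecedent formula is replaced by a context in which it holds and each
-- succedent formula by one in which it fails. Contracting a (CMC) conclusion removes repeated
-- pairs from its list, which is why equality of formulas has to be decided.

open import Defs
open import Data.Empty using (⊥-elim)
open import Data.List using (List; []; _∷_; _++_; map; filter; deduplicate)
open import Data.List.NonEmpty using (List⁺; toList; _⁺++_) renaming (_∷_ to _∷⁺_)
open import Data.List.Properties using (map-++)
open import Data.List.Membership.Propositional using (_∈_; _─_)
open import Data.List.Membership.Propositional.Properties
  using (∈-++⁻; ∈-map⁺; ∈-map⁻; ∈-filter⁺; ∈-filter⁻; ∈-deduplicate⁺; ∈-deduplicate⁻)
open import Data.List.Relation.Unary.Any using (here; there)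
open import Data.List.Relation.Unary.All as All using (All; []; _∷_)
import Data.List.Relation.Unary.All.Properties as All
open import Data.List.Relation.Unary.AllPairs using ([]; _∷_)
open import Data.List.Relation.Unary.Unique.Propositional using (Unique)
import Data.List.Relation.Unary.Unique.Propositional.Properties as Unique
open import Data.List.Relation.Unary.Unique.DecPropositional.Properties using (deduplicate-!)
open import Data.List.Relation.Binary.Permutation.Propositional
  using (_↭_; ↭-refl; ↭-sym; ↭-trans; prep; swap)
open import Data.List.Relation.Binary.Permutation.Propositional.Properties
  using (∈-resp-↭; ++⁺ˡ; shift; ++-comm; All-resp-↭)
open import Data.List.Relation.Binary.Subset.Propositional using (_⊆_)
open import Data.List.Relation.Binary.Subset.Propositional.Properties as ⊆
  using (All-resp-⊇; ∷⁺ʳ; ∈-∷⁺ʳ)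
open import Data.Nat as ℕ using ()
open import Data.Product using (_×_; _,_; proj₁; proj₂; ∃-syntax)
open import Data.Product.Properties using (≡-dec)
open import Data.Sum using (_⊎_; inj₁; inj₂; [_,_]′)
open import Data.Unit using (⊤)
open import Function using (_∘_; id)
open import Relation.Binary.Definitions using (DecidableEquality)
open import Relation.Binary.PropositionalEquality using (_≡_; _≢_; refl; cong; cong₂)
open import Relation.Nullary using (¬_; Dec; yes; no; map′; ¬?; _×-dec_)

infix 4 _≟_

binary-≟ : ∀ (_∙_ : Fm → Fm → Fm) {φ ψ φ′ ψ′} → (φ ∙ ψ ≡ φ′ ∙ ψ′ → φ ≡ φ′ × ψ ≡ ψ′) →
           Dec (φ ≡ φ′) → Dec (ψ ≡ ψ′) → Dec (φ ∙ ψ ≡ φ′ ∙ ψ′)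
binary-≟ _∙_ ∙-injective φ≟φ′ ψ≟ψ′ =
  map′ (λ (p , q) → cong₂ _∙_ p q) ∙-injective (φ≟φ′ ×-dec ψ≟ψ′)

_≟_ : DecidableEquality Fm
atom m ≟ atom n = map′ (cong atom) (λ { refl → refl }) (m ℕ.≟ n)
⊥' ≟ ⊥' = yes refl
(φ ∧' ψ) ≟ (φ′ ∧' ψ′) = binary-≟ _∧'_ (λ { refl → refl , refl }) (φ ≟ φ′) (ψ ≟ ψ′)
(φ ∨' ψ) ≟ (φ′ ∨' ψ′) = binary-≟ _∨'_ (λ { refl → refl , refl }) (φ ≟ φ′) (ψ ≟ ψ′)
(φ ⇒' ψ) ≟ (φ′ ⇒' ψ′) = binary-≟ _⇒'_ (λ { refl → refl , refl }) (φ ≟ φ′) (ψ ≟ ψ′)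
(φ ▷ ψ) ≟ (φ′ ▷ ψ′) = binary-≟ _▷_ (λ { refl → refl , refl }) (φ ≟ φ′) (ψ ≟ ψ′)
atom _ ≟ ⊥' = no λ ()
atom _ ≟ (_ ∧' _) = no λ ()
atom _ ≟ (_ ∨' _) = no λ ()
atom _ ≟ (_ ⇒' _) = no λ ()
atom _ ≟ (_ ▷ _) = no λ ()
⊥' ≟ atom _ = no λ ()
⊥' ≟ (_ ∧' _) = no λ ()
⊥' ≟ (_ ∨' _) = no λ ()
⊥' ≟ (_ ⇒' _) = no λ ()
⊥' ≟ (_ ▷ _) = no λ ()
(_ ∧' _) ≟ atom _ = no λ ()
(_ ∧' _) ≟ ⊥' = no λ ()
(_ ∧' _) ≟ (_ ∨' _) = no λ ()
(_ ∧' _) ≟ (_ ⇒' _) = no λ ()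
(_ ∧' _) ≟ (_ ▷ _) = no λ ()
(_ ∨' _) ≟ atom _ = no λ ()
(_ ∨' _) ≟ ⊥' = no λ ()
(_ ∨' _) ≟ (_ ∧' _) = no λ ()
(_ ∨' _) ≟ (_ ⇒' _) = no λ ()
(_ ∨' _) ≟ (_ ▷ _) = no λ ()
(_ ⇒' _) ≟ atom _ = no λ ()
(_ ⇒' _) ≟ ⊥' = no λ ()
(_ ⇒' _) ≟ (_ ∧' _) = no λ ()
(_ ⇒' _) ≟ (_ ∨' _) = no λ ()
(_ ⇒' _) ≟ (_ ▷ _) = no λ ()
(_ ▷ _) ≟ atom _ = no λ ()
(_ ▷ _) ≟ ⊥' = no λ ()
(_ ▷ _) ≟ (_ ∧' _) = no λ ()
(_ ▷ _) ≟ (_ ∨' _) = no λ ()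
(_ ▷ _) ≟ (_ ⇒' _) = no λ ()

open import Data.List.Membership.DecPropositional _≟_ using (_∈?_)

_≟×_ : DecidableEquality (Fm × Fm)
_≟×_ = ≡-dec _≟_ _≟_

-- Written with projections so that it is definitionally the function used by (CMC) in Defs.
cond : Fm × Fm → Fm
cond c = proj₁ c ▷ proj₂ c

cond-injective : ∀ {c d} → cond c ≡ cond d → c ≡ d
cond-injective {_ , _} {_ , _} refl = refl

-- toList (dedup⁺ cs) is definitionally deduplicate _≟×_ (toList cs).
dedup⁺ : List⁺ (Fm × Fm) → List⁺ (Fm × Fm)
dedup⁺ (c ∷⁺ cs) = c ∷⁺ filter (¬? ∘ (c ≟×_)) (deduplicate _≟×_ cs)

module _ {a} {A : Set a} where

  ─-↭ : ∀ {x : A} {xs} (x∈xs : x ∈ xs) → xs ↭ x ∷ (xs ─ x∈xs)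
  ─-↭ (here refl) = ↭-refl
  ─-↭ (there x∈xs) = ↭-trans (prep _ (─-↭ x∈xs)) (swap _ _ ↭-refl)

  ∈-─⁻ : ∀ {x y : A} {xs} (x∈xs : x ∈ xs) → y ∈ xs → y ≡ x ⊎ y ∈ xs ─ x∈xs
  ∈-─⁻ x∈xs y∈xs with ∈-resp-↭ (─-↭ x∈xs) y∈xs
  ... | here y≡x = inj₁ y≡x
  ... | there y∈xs─x = inj₂ y∈xs─x

  Unique∧⊆⇒↭++ : ∀ {xs ys : List A} → Unique xs → xs ⊆ ys → ∃[ zs ] ys ↭ xs ++ zs
  Unique∧⊆⇒↭++ {ys = ys} [] _ = ys , ↭-refl
  Unique∧⊆⇒↭++ {x ∷ xs} (x∉xs ∷ u) x∷xs⊆ys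
    with Unique∧⊆⇒↭++ u (x∷xs⊆ys ∘ there)
  ... | zs , ys↭xs++zs with ∈-++⁻ xs (∈-resp-↭ ys↭xs++zs (x∷xs⊆ys (here refl)))
  ... | inj₁ x∈xs = ⊥-elim (All.lookup x∉xs x∈xs refl)
  ... | inj₂ x∈zs = zs ─ x∈zs ,
        ↭-trans ys↭xs++zs (↭-trans (++⁺ˡ xs (─-↭ x∈zs)) (shift x xs (zs ─ x∈zs)))

  ∷-under : ∀ {x y : A} {xs ys} → xs ⊆ y ∷ ys → x ∷ xs ⊆ y ∷ x ∷ ys
  ∷-under xs⊆y∷ys = ∈-∷⁺ʳ (there (here refl)) (∷⁺ʳ _ there ∘ xs⊆y∷ys)

  ∈-tail : ∀ {x y : A} {xs} → x ∈ y ∷ xs → x ≢ y → x ∈ xs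
  ∈-tail (here x≡y) x≢y = ⊥-elim (x≢y x≡y)
  ∈-tail (there x∈xs) _ = x∈xs

_without_ : List (Fm × Fm) → Fm × Fm → List (Fm × Fm)
cs without c = filter (¬? ∘ (_≟× c)) cs

without-⊆ : ∀ cs {c} → cs without c ⊆ cs
without-⊆ cs = ⊆.filter-⊆ _ cs

cond-without : ∀ {cs c Γ} → map cond cs ⊆ cond c ∷ Γ → map cond (cs without c) ⊆ Γ
cond-without {cs} cs⊆c∷Γ d∈ with d , d∈cs-c , refl ← ∈-map⁻ cond d∈
  with d∈cs , d≢c ← ∈-filter⁻ (¬? ∘ (_≟× _)) {xs = cs} d∈cs-c
  = ∈-tail (cs⊆c∷Γ (∈-map⁺ cond d∈cs)) (d≢c ∘ cond-injective)

proj₂-without : ∀ cs c → map proj₂ cs ⊆ proj₂ c ∷ map proj₂ (cs without c)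
proj₂-without cs c ψ∈ with d , d∈cs , refl ← ∈-map⁻ proj₂ ψ∈ with d ≟× c
... | yes refl = here refl
... | no d≢c = there (∈-map⁺ proj₂ (∈-filter⁺ (¬? ∘ (_≟× c)) d∈cs d≢c))

∈-cond⁻ : ∀ {c cs} → cond c ∈ map cond cs → c ∈ cs
∈-cond⁻ c∈ with d , d∈cs , c≡d ← ∈-map⁻ cond c∈ rewrite cond-injective c≡d = d∈cs

CE-CM-disjoint : ∀ {G} → HasCE G → ¬ HasCM G
CE-CM-disjoint ce ()
CE-CM-disjoint cen ()

CE-CMC-disjoint : ∀ {G} → HasCE G → ¬ HasCMC G
CE-CMC-disjoint ce ()
CE-CMC-disjoint cen ()

CM-CMC-disjoint : ∀ {G} → HasCM G → ¬ HasCMC G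
CM-CMC-disjoint cm ()
CM-CMC-disjoint cmn ()

module Admissibility (G : Sys) where

  private
    variable
      A B φ ψ : Fm
      Γ Δ Γ′ Δ′ Γ₀ Δ₀ Γₗ Γᵣ Δₗ Δᵣ : Ctx

  on-left : (A∈Γ : A ∈ Γ) → G ⊢ A ∷ (Γ ─ A∈Γ) ⇒ Δ → G ⊢ Γ ⇒ Δ
  on-left A∈Γ = perm (↭-sym (─-↭ A∈Γ)) ↭-refl

  on-right : (A∈Δ : A ∈ Δ) → G ⊢ Γ ⇒ A ∷ (Δ ─ A∈Δ) → G ⊢ Γ ⇒ Δ
  on-right A∈Δ = perm ↭-refl (↭-sym (─-↭ A∈Δ))

  Lw* : ∀ Γ′ → G ⊢ Γ ⇒ Δ → G ⊢ Γ′ ++ Γ ⇒ Δ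
  Lw* [] d = d
  Lw* (_ ∷ Γ′) d = Lw (Lw* Γ′ d)

  Rw* : ∀ Δ′ → G ⊢ Γ ⇒ Δ → G ⊢ Γ ⇒ Δ′ ++ Δ
  Rw* [] d = d
  Rw* (_ ∷ Δ′) d = Rw (Rw* Δ′ d)

  weaken-↭ : ∀ {Γ′ Δ′} → G ⊢ Γ₀ ⇒ Δ₀ → Γ ↭ Γ₀ ++ Γ′ → Δ ↭ Δ₀ ++ Δ′ → G ⊢ Γ ⇒ Δ
  weaken-↭ {Γ₀} {Δ₀} {Γ′ = Γ′} {Δ′} d Γ↭ Δ↭ =
    perm (↭-trans (++-comm Γ′ Γ₀) (↭-sym Γ↭)) (↭-trans (++-comm Δ′ Δ₀) (↭-sym Δ↭))
         (Rw* Δ′ (Lw* Γ′ d))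

  weaken-∈ : G ⊢ A ∷ [] ⇒ B ∷ [] → A ∈ Γ → B ∈ Δ → G ⊢ Γ ⇒ Δ
  weaken-∈ d A∈Γ B∈Δ = weaken-↭ d (─-↭ A∈Γ) (─-↭ B∈Δ)

  weaken-∈ʳ : G ⊢ [] ⇒ B ∷ [] → B ∈ Δ → G ⊢ Γ ⇒ Δ
  weaken-∈ʳ {Γ = Γ} d B∈Δ = weaken-↭ {Γ′ = Γ} d ↭-refl (─-↭ B∈Δ)

  -- Semantically, A is true (false) wherever Γ is true
  -- and Δ false, so an antecedent (succedent) occurrence of A may be traded for Γ ⇒ Δ.
  data Holds (Γ Δ : Ctx) : Fm → Set
  data Fails (Γ Δ : Ctx) : Fm → Set

  data Holds Γ Δ where
    assumed  : A ∈ Γ → Holds Γ Δ A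
    ∧-holds  : Holds Γ Δ φ → Holds Γ Δ ψ → Holds Γ Δ (φ ∧' ψ)
    ∨-holdsˡ : Holds Γ Δ φ → Holds Γ Δ (φ ∨' ψ)
    ∨-holdsʳ : Holds Γ Δ ψ → Holds Γ Δ (φ ∨' ψ)
    ⇒-holdsˡ : Fails Γ Δ φ → Holds Γ Δ (φ ⇒' ψ)
    ⇒-holdsʳ : Holds Γ Δ ψ → Holds Γ Δ (φ ⇒' ψ)

  data Fails Γ Δ where
    refuted  : A ∈ Δ → Fails Γ Δ A
    ∧-failsˡ : Fails Γ Δ φ → Fails Γ Δ (φ ∧' ψ)
    ∧-failsʳ : Fails Γ Δ ψ → Fails Γ Δ (φ ∧' ψ)
    ∨-fails  : Fails Γ Δ φ → Fails Γ Δ ψ → Fails Γ Δ (φ ∨' ψ)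
    ⇒-fails  : Holds Γ Δ φ → Fails Γ Δ ψ → Fails Γ Δ (φ ⇒' ψ)

  Holds-▷ : Holds Γ Δ (φ ▷ ψ) → φ ▷ ψ ∈ Γ
  Holds-▷ (assumed φ▷ψ∈Γ) = φ▷ψ∈Γ

  Refines : Ctx → Ctx → Ctx → Ctx → Set
  Refines Γ Δ Γ′ Δ′ = All (Holds Γ′ Δ′) Γ × All (Fails Γ′ Δ′) Δ

  holds-mono : Refines Γ Δ Γ′ Δ′ → Holds Γ Δ A → Holds Γ′ Δ′ A
  fails-mono : Refines Γ Δ Γ′ Δ′ → Fails Γ Δ A → Fails Γ′ Δ′ A
  holds-mono r (assumed A∈Γ) = All.lookup (proj₁ r) A∈Γ
  holds-mono r (∧-holds h h′) = ∧-holds (holds-mono r h) (holds-mono r h′)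
  holds-mono r (∨-holdsˡ h) = ∨-holdsˡ (holds-mono r h)
  holds-mono r (∨-holdsʳ h) = ∨-holdsʳ (holds-mono r h)
  holds-mono r (⇒-holdsˡ f) = ⇒-holdsˡ (fails-mono r f)
  holds-mono r (⇒-holdsʳ h) = ⇒-holdsʳ (holds-mono r h)
  fails-mono r (refuted A∈Δ) = All.lookup (proj₂ r) A∈Δ
  fails-mono r (∧-failsˡ f) = ∧-failsˡ (fails-mono r f)
  fails-mono r (∧-failsʳ f) = ∧-failsʳ (fails-mono r f)
  fails-mono r (∨-fails f f′) = ∨-fails (fails-mono r f) (fails-mono r f′)
  fails-mono r (⇒-fails h f) = ⇒-fails (holds-mono r h) (fails-mono r f)

  refine-left : (A∈Γ : A ∈ Γ) → Holds Γ′ Δ′ A → Γ ─ A∈Γ ⊆ Γ′ → Δ ⊆ Δ′ → Refines Γ Δ Γ′ Δ′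
  refine-left A∈Γ h Γ─A⊆Γ′ Δ⊆Δ′ =
    All.tabulate (holds ∘ ∈-─⁻ A∈Γ) , All.tabulate (refuted ∘ Δ⊆Δ′)
    where
    holds : ∀ {B} → B ≡ _ ⊎ B ∈ _ → Holds _ _ B
    holds (inj₁ refl) = h
    holds (inj₂ B∈Γ─A) = assumed (Γ─A⊆Γ′ B∈Γ─A)

  refine-right : (A∈Δ : A ∈ Δ) → Fails Γ′ Δ′ A → Γ ⊆ Γ′ → Δ ─ A∈Δ ⊆ Δ′ → Refines Γ Δ Γ′ Δ′
  refine-right A∈Δ f Γ⊆Γ′ Δ─A⊆Δ′ =
    All.tabulate (assumed ∘ Γ⊆Γ′) , All.tabulate (fails ∘ ∈-─⁻ A∈Δ)
    where
    fails : ∀ {B} → B ≡ _ ⊎ B ∈ _ → Fails _ _ B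
    fails (inj₁ refl) = f
    fails (inj₂ B∈Δ─A) = refuted (Δ─A⊆Δ′ B∈Δ─A)

  CMC-Unique : HasCMC G → ∀ {φ₀ ψ₀} (cs : List⁺ (Fm × Fm)) →
               All (λ c → G ⊢ φ₀ ∷ [] ⇒ proj₁ c ∷ []) (toList cs) →
               All (λ c → G ⊢ proj₁ c ∷ [] ⇒ φ₀ ∷ []) (toList cs) →
               G ⊢ map proj₂ (toList cs) ⇒ ψ₀ ∷ [] →
               Unique (toList cs) → map cond (toList cs) ⊆ Γ → φ₀ ▷ ψ₀ ∈ Δ → G ⊢ Γ ⇒ Δ
  CMC-Unique h cs φ₀⇒ ⇒φ₀ d unique cs⊆Γ φ₀▷ψ₀∈Δ
    with Γ′ , Γ↭ ← Unique∧⊆⇒↭++ (Unique.map⁺ cond-injective unique) cs⊆Γ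
    = weaken-↭ (CMC h cs φ₀⇒ ⇒φ₀ d) Γ↭ (─-↭ φ₀▷ψ₀∈Δ)

  transfer : G ⊢ Γ ⇒ Δ → All (Holds Γ′ Δ′) Γ → All (Fails Γ′ Δ′) Δ → G ⊢ Γ′ ⇒ Δ′
  transfer (perm Γ↭ Δ↭ d) hs fs = transfer d (All-resp-↭ (↭-sym Γ↭) hs) (All-resp-↭ (↭-sym Δ↭) fs)
  transfer (ax p) (assumed p∈Γ′ ∷ _) (refuted p∈Δ′ ∷ _) =
    perm (↭-sym (─-↭ p∈Γ′)) (↭-sym (─-↭ p∈Δ′)) (ax p)
  transfer L⊥ (assumed ⊥∈Γ′ ∷ _) _ = on-left ⊥∈Γ′ L⊥
  transfer (L∧ d) (∧-holds h h′ ∷ hs) fs = transfer d (h ∷ h′ ∷ hs) fs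
  transfer (L∧ d) (assumed m ∷ hs) fs =
    on-left m (L∧ (transfer d (assumed (here refl) ∷ assumed (there (here refl)) ∷ All.map (holds-mono r) hs)
                              (All.map (fails-mono r) fs)))
    where r = refine-left m (∧-holds (assumed (here refl)) (assumed (there (here refl)))) (there ∘ there) id
  transfer (L∨ d d′) (∨-holdsˡ h ∷ hs) fs = transfer d (h ∷ hs) fs
  transfer (L∨ d d′) (∨-holdsʳ h ∷ hs) fs = transfer d′ (h ∷ hs) fs
  transfer (L∨ d d′) (assumed m ∷ hs) fs =
    on-left m (L∨ (transfer d (assumed (here refl) ∷ All.map (holds-mono r) hs) (All.map (fails-mono r) fs))
                  (transfer d′ (assumed (here refl) ∷ All.map (holds-mono r′) hs)
                               (All.map (fails-mono r′) fs)))
    where r = refine-left m (∨-holdsˡ (assumed (here refl))) there id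
          r′ = refine-left m (∨-holdsʳ (assumed (here refl))) there id
  transfer (L→ d d′) (⇒-holdsˡ f ∷ hs) fs = transfer d hs (f ∷ fs)
  transfer (L→ d d′) (⇒-holdsʳ h ∷ hs) fs = transfer d′ (h ∷ hs) fs
  transfer (L→ d d′) (assumed m ∷ hs) fs =
    on-left m (L→ (transfer d (All.map (holds-mono r) hs) (refuted (here refl) ∷ All.map (fails-mono r) fs))
                  (transfer d′ (assumed (here refl) ∷ All.map (holds-mono r′) hs)
                               (All.map (fails-mono r′) fs)))
    where r = refine-left m (⇒-holdsˡ (refuted (here refl))) id there
          r′ = refine-left m (⇒-holdsʳ (assumed (here refl))) there id
  transfer (R∧ d d′) hs (∧-failsˡ f ∷ fs) = transfer d hs (f ∷ fs)
  transfer (R∧ d d′) hs (∧-failsʳ f ∷ fs) = transfer d′ hs (f ∷ fs)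
  transfer (R∧ d d′) hs (refuted m ∷ fs) =
    on-right m (R∧ (transfer d (All.map (holds-mono r) hs) (refuted (here refl) ∷ All.map (fails-mono r) fs))
                   (transfer d′ (All.map (holds-mono r′) hs)
                                (refuted (here refl) ∷ All.map (fails-mono r′) fs)))
    where r = refine-right m (∧-failsˡ (refuted (here refl))) id there
          r′ = refine-right m (∧-failsʳ (refuted (here refl))) id there
  transfer (R∨ d) hs (∨-fails f f′ ∷ fs) = transfer d hs (f ∷ f′ ∷ fs)
  transfer (R∨ d) hs (refuted m ∷ fs) =
    on-right m (R∨ (transfer d (All.map (holds-mono r) hs)
                               (refuted (here refl) ∷ refuted (there (here refl)) ∷ All.map (fails-mono r) fs)))
    where r = refine-right m (∨-fails (refuted (here refl)) (refuted (there (here refl)))) id (there ∘ there)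
  transfer (R→ d) hs (⇒-fails h f ∷ fs) = transfer d (h ∷ hs) (f ∷ fs)
  transfer (R→ d) hs (refuted m ∷ fs) =
    on-right m (R→ (transfer d (assumed (here refl) ∷ All.map (holds-mono r) hs)
                               (refuted (here refl) ∷ All.map (fails-mono r) fs)))
    where r = refine-right m (⇒-fails (assumed (here refl)) (refuted (here refl))) there there
  transfer (Lw d) (_ ∷ hs) fs = transfer d hs fs
  transfer (Rw d) hs (_ ∷ fs) = transfer d hs fs
  transfer (CE h d₁ d₂ d₃ d₄) (assumed m ∷ []) (refuted k ∷ []) = weaken-∈ (CE h d₁ d₂ d₃ d₄) m k
  transfer (CM h d₁ d₂ d₃) (assumed m ∷ []) (refuted k ∷ []) = weaken-∈ (CM h d₁ d₂ d₃) m k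
  transfer (CN h d) [] (refuted k ∷ []) = weaken-∈ʳ (CN h d) k
  transfer (CMC h cs φ₀⇒ ⇒φ₀ d) hs (refuted k ∷ []) =
    CMC-Unique h (dedup⁺ cs) (All-resp-⊇ dedup⊆cs φ₀⇒) (All-resp-⊇ dedup⊆cs ⇒φ₀)
      (transfer d (All.tabulate ψ-assumed) (refuted (here refl) ∷ []))
      (deduplicate-! _≟×_ (toList cs)) dedup-in-Γ′ k
    where
    dedup⊆cs : toList (dedup⁺ cs) ⊆ toList cs
    dedup⊆cs = ∈-deduplicate⁻ _≟×_ (toList cs)
    ψ-assumed : ∀ {ψ} → ψ ∈ map proj₂ (toList cs) → Holds (map proj₂ (toList (dedup⁺ cs))) _ ψ
    ψ-assumed ψ∈ with c , c∈cs , refl ← ∈-map⁻ proj₂ ψ∈ =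
      assumed (∈-map⁺ proj₂ (∈-deduplicate⁺ _≟×_ c∈cs))
    dedup-in-Γ′ : map cond (toList (dedup⁺ cs)) ⊆ _
    dedup-in-Γ′ A∈ with c , c∈ , refl ← ∈-map⁻ cond A∈ =
      Holds-▷ (All.lookup hs (∈-map⁺ cond (dedup⊆cs c∈)))

  weaken-⊆ : G ⊢ Γ₀ ⇒ Δ₀ → Γ₀ ⊆ Γ → Δ₀ ⊆ Δ → G ⊢ Γ ⇒ Δ
  weaken-⊆ d Γ₀⊆Γ Δ₀⊆Δ = transfer d (All.tabulate (assumed ∘ Γ₀⊆Γ)) (All.tabulate (refuted ∘ Δ₀⊆Δ))

  invert-left : Holds Γ′ Δ′ A → G ⊢ A ∷ Γ ⇒ Δ → Γ ⊆ Γ′ → Δ ⊆ Δ′ → G ⊢ Γ′ ⇒ Δ′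
  invert-left h d Γ⊆Γ′ Δ⊆Δ′ =
    transfer d (h ∷ All.tabulate (assumed ∘ Γ⊆Γ′)) (All.tabulate (refuted ∘ Δ⊆Δ′))

  contractˡ : A ∈ Γ → G ⊢ A ∷ Γ ⇒ Δ → G ⊢ Γ ⇒ Δ
  contractˡ A∈Γ d = weaken-⊆ d (∈-∷⁺ʳ A∈Γ id) id

  contractʳ : A ∈ Δ → G ⊢ Γ ⇒ A ∷ Δ → G ⊢ Γ ⇒ Δ
  contractʳ A∈Δ d = weaken-⊆ d id (∈-∷⁺ʳ A∈Δ id)

  Cut : Fm → Set
  Cut A = ∀ {Γ Δ} → G ⊢ Γ ⇒ A ∷ Δ → G ⊢ A ∷ Γ ⇒ Δ → G ⊢ Γ ⇒ Δ

  SubformulaCuts : Fm → Set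
  SubformulaCuts (φ ∧' ψ) = Cut φ × Cut ψ
  SubformulaCuts (φ ∨' ψ) = Cut φ × Cut ψ
  SubformulaCuts (φ ⇒' ψ) = Cut φ × Cut ψ
  SubformulaCuts (φ ▷ ψ) = Cut φ × Cut ψ
  SubformulaCuts (atom _) = ⊤
  SubformulaCuts ⊥' = ⊤

  cut-⊆ : Cut A → G ⊢ Γ₀ ⇒ A ∷ [] → G ⊢ A ∷ Γ′ ⇒ Δ → Γ₀ ⊆ Γ → Γ′ ⊆ Γ → G ⊢ Γ ⇒ Δ
  cut-⊆ cut d d′ Γ₀⊆Γ Γ′⊆Γ = cut (weaken-⊆ d Γ₀⊆Γ (∷⁺ʳ _ λ ())) (weaken-⊆ d′ (∷⁺ʳ _ Γ′⊆Γ) id)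

  ⊢-trans : Cut A → G ⊢ Γ ⇒ A ∷ [] → G ⊢ A ∷ [] ⇒ Δ → G ⊢ Γ ⇒ Δ
  ⊢-trans cut d d′ = cut-⊆ cut d d′ id λ ()

  cut-∧ : Cut φ → Cut ψ → G ⊢ Γ ⇒ φ ∷ Δ → G ⊢ Γ ⇒ ψ ∷ Δ → G ⊢ φ ∧' ψ ∷ Γ ⇒ Δ → G ⊢ Γ ⇒ Δ
  cut-∧ cutφ cutψ dφ dψ d∧ =
    cutφ dφ (cutψ (Lw dψ) (invert-left ψ∧φ d∧ (there ∘ there) id))
    where ψ∧φ = ∧-holds (assumed (there (here refl))) (assumed (here refl))

  cut-∨ : Cut φ → Cut ψ → G ⊢ Γ ⇒ φ ∷ ψ ∷ Δ → G ⊢ (φ ∨' ψ) ∷ Γ ⇒ Δ → G ⊢ Γ ⇒ Δ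
  cut-∨ cutφ cutψ dφψ d∨ =
    cutψ (cutφ dφψ (invert-left (∨-holdsˡ (assumed (here refl))) d∨ there there))
         (invert-left (∨-holdsʳ (assumed (here refl))) d∨ there id)

  cut-⇒ : Cut φ → Cut ψ → G ⊢ φ ∷ Γ ⇒ ψ ∷ Δ → G ⊢ (φ ⇒' ψ) ∷ Γ ⇒ Δ → G ⊢ Γ ⇒ Δ
  cut-⇒ cutφ cutψ dφψ d⇒ =
    cutφ (invert-left (⇒-holdsˡ (refuted (here refl))) d⇒ id there)
         (cutψ dφψ (invert-left (⇒-holdsʳ (assumed (here refl))) d⇒ (there ∘ there) id))

  data Conditional : Ctx → Fm → Fm → Set where
    byCE  : HasCE G → ∀ {φ₀ φ₁ ψ₀ ψ₁} →
            G ⊢ φ₀ ∷ [] ⇒ φ₁ ∷ [] → G ⊢ φ₁ ∷ [] ⇒ φ₀ ∷ [] →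
            G ⊢ ψ₀ ∷ [] ⇒ ψ₁ ∷ [] → G ⊢ ψ₁ ∷ [] ⇒ ψ₀ ∷ [] →
            Conditional (φ₁ ▷ ψ₁ ∷ []) φ₀ ψ₀
    byCM  : HasCM G → ∀ {φ₀ φ₁ ψ₀ ψ₁} →
            G ⊢ φ₀ ∷ [] ⇒ φ₁ ∷ [] → G ⊢ φ₁ ∷ [] ⇒ φ₀ ∷ [] →
            G ⊢ ψ₁ ∷ [] ⇒ ψ₀ ∷ [] →
            Conditional (φ₁ ▷ ψ₁ ∷ []) φ₀ ψ₀
    byCMC : HasCMC G → ∀ {φ₀ ψ₀} (cs : List⁺ (Fm × Fm)) →
            All (λ c → G ⊢ φ₀ ∷ [] ⇒ proj₁ c ∷ []) (toList cs) →
            All (λ c → G ⊢ proj₁ c ∷ [] ⇒ φ₀ ∷ []) (toList cs) →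
            G ⊢ map proj₂ (toList cs) ⇒ ψ₀ ∷ [] →
            Conditional (map cond (toList cs)) φ₀ ψ₀
    byCN  : HasCN G → ∀ {φ₀ ψ₀} → G ⊢ [] ⇒ ψ₀ ∷ [] → Conditional [] φ₀ ψ₀

  conclusion : Conditional Γ φ ψ → G ⊢ Γ ⇒ φ ▷ ψ ∷ []
  conclusion (byCE h d₁ d₂ d₃ d₄) = CE h d₁ d₂ d₃ d₄
  conclusion (byCM h d₁ d₂ d₃) = CM h d₁ d₂ d₃
  conclusion (byCMC h cs d₁ d₂ d₃) = CMC h cs d₁ d₂ d₃
  conclusion (byCN h d) = CN h d

  -- In GCK, (CN) is the case n = 0 of (CMC).
  CMC₀ : HasCMC G → HasCN G → (cs : List (Fm × Fm)) →
         All (λ c → G ⊢ φ ∷ [] ⇒ proj₁ c ∷ []) cs → All (λ c → G ⊢ proj₁ c ∷ [] ⇒ φ ∷ []) cs →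
         G ⊢ map proj₂ cs ⇒ ψ ∷ [] → G ⊢ map cond cs ⇒ φ ▷ ψ ∷ []
  CMC₀ _ hn [] _ _ d = CN hn d
  CMC₀ hc _ (c ∷ cs) φ⇒ ⇒φ d = CMC hc (c ∷⁺ cs) φ⇒ ⇒φ d

  module _ {φ₀ ψ₀} (cutφ₀ : Cut φ₀) (cutψ₀ : Cut ψ₀) where

    cut-conditionals : Conditional Γₗ φ₀ ψ₀ → Conditional Γᵣ φ ψ → φ₀ ▷ ψ₀ ∈ Γᵣ →
                       Γₗ ⊆ Γ → Γᵣ ⊆ φ₀ ▷ ψ₀ ∷ Γ → G ⊢ Γ ⇒ φ ▷ ψ ∷ []
    cut-conditionals (byCE h l₁ l₂ l₃ l₄) (byCE _ r₁ r₂ r₃ r₄) (here refl) Γₗ⊆Γ _ =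
      weaken-⊆ (CE h (⊢-trans cutφ₀ r₁ l₁) (⊢-trans cutφ₀ l₂ r₂) (⊢-trans cutψ₀ r₃ l₃) (⊢-trans cutψ₀ l₄ r₄))
               Γₗ⊆Γ id
    cut-conditionals (byCM h l₁ l₂ l₃) (byCM _ r₁ r₂ r₃) (here refl) Γₗ⊆Γ _ =
      weaken-⊆ (CM h (⊢-trans cutφ₀ r₁ l₁) (⊢-trans cutφ₀ l₂ r₂) (⊢-trans cutψ₀ l₃ r₃)) Γₗ⊆Γ id
    cut-conditionals (byCN h l) (byCE _ _ _ _ r₄) (here refl) _ _ =
      weaken-⊆ (CN h (⊢-trans cutψ₀ l r₄)) (λ ()) id
    cut-conditionals (byCN h l) (byCM _ _ _ r₃) (here refl) _ _ =
      weaken-⊆ (CN h (⊢-trans cutψ₀ l r₃)) (λ ()) id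
    cut-conditionals (byCN h l) (byCMC h′ ds φ⇒ ⇒φ r) _ _ ds⊆ =
      weaken-⊆ (CMC₀ h′ h rest (All-resp-⊇ rest⊆ds φ⇒) (All-resp-⊇ rest⊆ds ⇒φ)
                  (cut-⊆ cutψ₀ l (weaken-⊆ r (proj₂-without (toList ds) _) id) (λ ()) id))
               (cond-without ds⊆) id
      where rest = toList ds without (φ₀ , ψ₀)
            rest⊆ds = without-⊆ (toList ds)
    cut-conditionals {φ = φ} {ψ} (byCMC h cs φ₀⇒ ⇒φ₀ l) (byCMC _ ds φ⇒ ⇒φ r) φ₀▷ψ₀∈ds Γₗ⊆Γ ds⊆ =
      weaken-⊆ (CMC h (cs ⁺++ rest) φ⇒cs++rest cs++rest⇒φ cs++rest⇒ψ) cs++rest⊆Γ id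
      where
      rest = toList ds without (φ₀ , ψ₀)
      rest⊆ds = without-⊆ (toList ds)
      φ₀ψ₀∈ds = ∈-cond⁻ φ₀▷ψ₀∈ds
      φ⇒cs++rest : All (λ c → G ⊢ φ ∷ [] ⇒ proj₁ c ∷ []) (toList cs ++ rest)
      φ⇒cs++rest =
        All.++⁺ (All.map (⊢-trans cutφ₀ (All.lookup φ⇒ φ₀ψ₀∈ds)) φ₀⇒) (All-resp-⊇ rest⊆ds φ⇒)
      cs++rest⇒φ : All (λ c → G ⊢ proj₁ c ∷ [] ⇒ φ ∷ []) (toList cs ++ rest)
      cs++rest⇒φ =
        All.++⁺ (All.map (λ d → ⊢-trans cutφ₀ d (All.lookup ⇒φ φ₀ψ₀∈ds)) ⇒φ₀) (All-resp-⊇ rest⊆ds ⇒φ)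
      cs++rest⇒ψ : G ⊢ map proj₂ (toList cs ++ rest) ⇒ ψ ∷ []
      cs++rest⇒ψ = cut-⊆ cutψ₀ l (weaken-⊆ r (proj₂-without (toList ds) _) id)
                     (⊆.map⁺ proj₂ (⊆.xs⊆xs++ys (toList cs) rest))
                     (⊆.map⁺ proj₂ (⊆.xs⊆ys++xs rest (toList cs)))
      cs++rest⊆Γ : map cond (toList cs ++ rest) ⊆ _
      cs++rest⊆Γ rewrite map-++ cond (toList cs) rest =
        [ Γₗ⊆Γ , cond-without ds⊆ ]′ ∘ ∈-++⁻ (map cond (toList cs))
    cut-conditionals _ (byCN _ _) () _ _
    cut-conditionals (byCE h _ _ _ _) (byCM h′ _ _ _) _ _ _ = ⊥-elim (CE-CM-disjoint h h′)
    cut-conditionals (byCE h _ _ _ _) (byCMC h′ _ _ _ _) _ _ _ = ⊥-elim (CE-CMC-disjoint h h′)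
    cut-conditionals (byCM h _ _ _) (byCE h′ _ _ _ _) _ _ _ = ⊥-elim (CE-CM-disjoint h′ h)
    cut-conditionals (byCM h _ _ _) (byCMC h′ _ _ _ _) _ _ _ = ⊥-elim (CM-CMC-disjoint h h′)
    cut-conditionals (byCMC h _ _ _ _) (byCE h′ _ _ _ _) _ _ _ = ⊥-elim (CE-CMC-disjoint h′ h)
    cut-conditionals (byCMC h _ _ _ _) (byCM h′ _ _ _) _ _ _ = ⊥-elim (CM-CMC-disjoint h′ h)

    module _ {Γₗ} (left : Conditional Γₗ φ₀ ψ₀) where

      cut-conditional-right : Conditional Γᵣ φ ψ → Γₗ ⊆ Γ → Γᵣ ⊆ φ₀ ▷ ψ₀ ∷ Γ → φ ▷ ψ ∈ Δ →
                              G ⊢ Γ ⇒ Δ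
      cut-conditional-right {Γᵣ} right sl sr φ▷ψ∈Δ with φ₀ ▷ ψ₀ ∈? Γᵣ
      ... | yes φ₀▷ψ₀∈Γᵣ =
        weaken-⊆ (cut-conditionals left right φ₀▷ψ₀∈Γᵣ sl sr) id (∈-∷⁺ʳ φ▷ψ∈Δ λ ())
      ... | no φ₀▷ψ₀∉Γᵣ =
        weaken-⊆ (conclusion right) (⊆.⊆∷∧∉⇒⊆ sr φ₀▷ψ₀∉Γᵣ) (∈-∷⁺ʳ φ▷ψ∈Δ λ ())

      cut-right : G ⊢ Γᵣ ⇒ Δᵣ → Γₗ ⊆ Γ → Γᵣ ⊆ φ₀ ▷ ψ₀ ∷ Γ → Δᵣ ⊆ Δ → G ⊢ Γ ⇒ Δ
      cut-right (perm p q d) sl sr sd = cut-right d sl (sr ∘ ∈-resp-↭ p) (sd ∘ ∈-resp-↭ q)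
      cut-right (ax p) sl sr sd = weaken-∈ (ax p) (∈-tail (sr (here refl)) λ ()) (sd (here refl))
      cut-right L⊥ sl sr sd = on-left (∈-tail (sr (here refl)) λ ()) L⊥
      cut-right (L∧ d) sl sr sd =
        contractˡ (∈-tail (sr (here refl)) λ ())
          (L∧ (cut-right d (there ∘ there ∘ sl) (∷-under (∷-under (sr ∘ there))) sd))
      cut-right (L∨ d d′) sl sr sd =
        contractˡ (∈-tail (sr (here refl)) λ ())
          (L∨ (cut-right d (there ∘ sl) (∷-under (sr ∘ there)) sd)
              (cut-right d′ (there ∘ sl) (∷-under (sr ∘ there)) sd))
      cut-right (L→ d d′) sl sr sd =
        contractˡ (∈-tail (sr (here refl)) λ ())
          (L→ (cut-right d sl (sr ∘ there) (∷⁺ʳ _ sd))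
              (cut-right d′ (there ∘ sl) (∷-under (sr ∘ there)) sd))
      cut-right (R∧ d d′) sl sr sd =
        contractʳ (sd (here refl))
          (R∧ (cut-right d sl sr (∷⁺ʳ _ (sd ∘ there))) (cut-right d′ sl sr (∷⁺ʳ _ (sd ∘ there))))
      cut-right (R∨ d) sl sr sd =
        contractʳ (sd (here refl)) (R∨ (cut-right d sl sr (∷⁺ʳ _ (∷⁺ʳ _ (sd ∘ there)))))
      cut-right (R→ d) sl sr sd =
        contractʳ (sd (here refl)) (R→ (cut-right d (there ∘ sl) (∷-under sr) (∷⁺ʳ _ (sd ∘ there))))
      cut-right (Lw d) sl sr sd = cut-right d sl (sr ∘ there) sd
      cut-right (Rw d) sl sr sd = cut-right d sl sr (sd ∘ there)
      cut-right (CE h d₁ d₂ d₃ d₄) sl sr sd =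
        cut-conditional-right (byCE h d₁ d₂ d₃ d₄) sl sr (sd (here refl))
      cut-right (CM h d₁ d₂ d₃) sl sr sd = cut-conditional-right (byCM h d₁ d₂ d₃) sl sr (sd (here refl))
      cut-right (CMC h cs d₁ d₂ d₃) sl sr sd =
        cut-conditional-right (byCMC h cs d₁ d₂ d₃) sl sr (sd (here refl))
      cut-right (CN h d) sl sr sd = cut-conditional-right (byCN h d) sl sr (sd (here refl))

  principal-or-contract : B ∈ A ∷ Δ → G ⊢ Γ ⇒ B ∷ Δ → (B ≡ A → G ⊢ Γ ⇒ Δ) → G ⊢ Γ ⇒ Δ
  principal-or-contract (here B≡A) _ principal = principal B≡A
  principal-or-contract (there B∈Δ) d _ = contractʳ B∈Δ d

  cut-left-conditional : SubformulaCuts A → Conditional Γₗ φ ψ → Γₗ ⊆ Γ → φ ▷ ψ ∈ A ∷ Δ →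
                         G ⊢ A ∷ Γ ⇒ Δ → G ⊢ Γ ⇒ Δ
  cut-left-conditional sc left sl φ▷ψ∈ r =
    principal-or-contract φ▷ψ∈ (weaken-⊆ (conclusion left) sl (∷⁺ʳ _ λ ()))
      λ { refl → cut-right (proj₁ sc) (proj₂ sc) left r sl id id }

  cut-left : SubformulaCuts A → G ⊢ Γₗ ⇒ Δₗ → Γₗ ⊆ Γ → Δₗ ⊆ A ∷ Δ → G ⊢ A ∷ Γ ⇒ Δ → G ⊢ Γ ⇒ Δ
  cut-left sc (perm p q d) sl sd r = cut-left sc d (sl ∘ ∈-resp-↭ p) (sd ∘ ∈-resp-↭ q) r
  cut-left sc (ax p) sl sd r =
    principal-or-contract (sd (here refl)) (weaken-∈ (ax p) (sl (here refl)) (here refl))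
      λ { refl → contractˡ (sl (here refl)) r }
  cut-left sc L⊥ sl sd r = on-left (sl (here refl)) L⊥
  cut-left sc (L∧ d) sl sd r =
    contractˡ (sl (here refl))
      (L∧ (cut-left sc d (∷⁺ʳ _ (∷⁺ʳ _ (sl ∘ there))) sd (weaken-⊆ r (∷⁺ʳ _ (there ∘ there)) id)))
  cut-left sc (L∨ d d′) sl sd r =
    contractˡ (sl (here refl))
      (L∨ (cut-left sc d (∷⁺ʳ _ (sl ∘ there)) sd (weaken-⊆ r (∷⁺ʳ _ there) id))
          (cut-left sc d′ (∷⁺ʳ _ (sl ∘ there)) sd (weaken-⊆ r (∷⁺ʳ _ there) id)))
  cut-left sc (L→ d d′) sl sd r =
    contractˡ (sl (here refl))
      (L→ (cut-left sc d (sl ∘ there) (∷-under sd) (Rw r))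
          (cut-left sc d′ (∷⁺ʳ _ (sl ∘ there)) sd (weaken-⊆ r (∷⁺ʳ _ there) id)))
  cut-left sc (R∧ d d′) sl sd r =
    principal-or-contract (sd (here refl)) (R∧ e e′) λ { refl → cut-∧ (proj₁ sc) (proj₂ sc) e e′ r }
    where e = cut-left sc d sl (∷-under (sd ∘ there)) (Rw r)
          e′ = cut-left sc d′ sl (∷-under (sd ∘ there)) (Rw r)
  cut-left sc (R∨ d) sl sd r =
    principal-or-contract (sd (here refl)) (R∨ e) λ { refl → cut-∨ (proj₁ sc) (proj₂ sc) e r }
    where e = cut-left sc d sl (∷-under (∷-under (sd ∘ there))) (Rw (Rw r))
  cut-left sc (R→ d) sl sd r =
    principal-or-contract (sd (here refl)) (R→ e) λ { refl → cut-⇒ (proj₁ sc) (proj₂ sc) e r }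
    where e = cut-left sc d (∷⁺ʳ _ sl) (∷-under (sd ∘ there)) (weaken-⊆ r (∷⁺ʳ _ there) there)
  cut-left sc (Lw d) sl sd r = cut-left sc d (sl ∘ there) sd r
  cut-left sc (Rw d) sl sd r = cut-left sc d sl (sd ∘ there) r
  cut-left sc (CE h d₁ d₂ d₃ d₄) sl sd r =
    cut-left-conditional sc (byCE h d₁ d₂ d₃ d₄) sl (sd (here refl)) r
  cut-left sc (CM h d₁ d₂ d₃) sl sd r = cut-left-conditional sc (byCM h d₁ d₂ d₃) sl (sd (here refl)) r
  cut-left sc (CMC h cs d₁ d₂ d₃) sl sd r =
    cut-left-conditional sc (byCMC h cs d₁ d₂ d₃) sl (sd (here refl)) r
  cut-left sc (CN h d) sl sd r = cut-left-conditional sc (byCN h d) sl (sd (here refl)) r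

  cut : ∀ A → Cut A
  subformula-cuts : ∀ A → SubformulaCuts A
  cut A d r = cut-left (subformula-cuts A) d id id r
  subformula-cuts (φ ∧' ψ) = cut φ , cut ψ
  subformula-cuts (φ ∨' ψ) = cut φ , cut ψ
  subformula-cuts (φ ⇒' ψ) = cut φ , cut ψ
  subformula-cuts (φ ▷ ψ) = cut φ , cut ψ
  subformula-cuts (atom _) = _
  subformula-cuts ⊥' = _

mainTheorem3 : (G : Sys) → ∀ {Γ₁ Δ₁ Γ₂ Δ₂} φ →
    G ⊢ Γ₁ ⇒ φ ∷ Δ₁ → G ⊢ φ ∷ Γ₂ ⇒ Δ₂ → G ⊢ Γ₁ ++ Γ₂ ⇒ Δ₁ ++ Δ₂
mainTheorem3 G {Γ₁} {Δ₁} {Γ₂} {Δ₂} φ d₁ d₂ =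
  cut φ (weaken-⊆ d₁ (⊆.xs⊆xs++ys Γ₁ Γ₂) (∷⁺ʳ φ (⊆.xs⊆xs++ys Δ₁ Δ₂)))
        (weaken-⊆ d₂ (∷⁺ʳ φ (⊆.xs⊆ys++xs Γ₂ Γ₁)) (⊆.xs⊆ys++xs Δ₂ Δ₁))
  where open Admissibility G
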